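{- Let $\{x_{n,l}\}$ be real numbers indexed by positive integers $n,l$, and for $n\ge 1$ and $m\in\mathbb{Z}$ put $X_{n,m}=\prod_{l=1}^{n}(m+x_{n,l})$ and $\mathscr{X}_n=\sum_{l=1}^{n}x_{n,l}$. Then for all $n\ge1$ and $m\in\mathbb{Z}$, \[ \mathscr{X}_n=\frac{(-1)^n}{n!}\sum_{l=1}^{n}(-1)^l\binom{n}{l}\,l\,X_{n,l+m}-\frac12 n(n+1)-nm, \] and, for $m\neq 0$, \[ \mathscr{X}_n=\frac{(-1)^n}{n!\,m^{n-1}}\sum_{l=1}^{n}(-1)^l\binom{n}{l}\,l\,X_{n,lm}-\frac12 n(n+1)m. \]
   Context: Given a two-parameter set of real numbers $\{x_{n,l}\}$, the associated family of number sequences consists of $X_{n,m}=\prod_{l=1}^n(m+x_{n,l})$, $n\ge1$, $m\in\mathbb{Z}$; $\mathscr{X}_n=\sum_{l=1}^n x_{n,l}$. -}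

module Defs where

open import Level using (Level)
open import Algebra.Bundles using (CommutativeRing)
open import Data.Nat as ℕ using (ℕ; zero; suc)
open import Data.Integer as ℤ using (ℤ; +_; -[1+_])

-- Definitions over an arbitrary commutative ring R (the paper works in ℝ).
module RingDefs {c ℓ : Level} (R : CommutativeRing c ℓ) where
  open CommutativeRing R

  ι : ℕ → Carrier
  ι zero = 0#
  ι (suc n) = 1# + ι n

  ιℤ : ℤ → Carrier
  ιℤ (+ n) = ι n
  ιℤ -[1+ n ] = - ι (suc n)

  pow : Carrier → ℕ → Carrier
  pow a zero = 1#
  pow a (suc n) = a * pow a n

  sum1 : ℕ → (ℕ → Carrier) → Carrier
  sum1 zero f = 0#
  sum1 (suc n) f = sum1 n f + f (suc n)

  prod1 : ℕ → (ℕ → Carrier) → Carrier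
  prod1 zero f = 1#
  prod1 (suc n) f = prod1 n f * f (suc n)

  X : (ℕ → ℕ → Carrier) → ℕ → ℤ → Carrier
  X x n m = prod1 n (λ l → ιℤ m + x n l)

  𝒳 : (ℕ → ℕ → Carrier) → ℕ → Carrier
  𝒳 x n = sum1 n (λ l → x n l)

-- Σ_{l=0}^{n} (−1)^l C(n,l) g(l) is ((1 − E)ⁿ g)(0), E the shift, and both formulas take
-- g(t) = t · Π_{i=1}^{n} (a t + y_i): a = 1, y_i = x_{n,i} + m for the first, a = m, y_i = x_{n,i}
-- for the second. Splitting off one affine factor at a time, (1 − E)ⁿ annihilates products of
-- fewer than n such factors and sends a product of exactly n of them to (−1)ⁿ n! aⁿ; tracking
-- the next coefficient gives ((1 − E)ⁿ g)(0) = (−1)ⁿ n! a^{n−1} (Σ_i y_i + a n(n+1)/2).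

module Submission where

open import Defs
open import Level using (Level)
open import Algebra.Bundles using (CommutativeRing)
open import Data.Nat as ℕ using (ℕ; zero; suc; _≤_; _<_; z≤n; s≤s)
open import Data.Nat.Combinatorics using (_C_; nCk+nC[k+1]≡[n+1]C[k+1]; k>n⇒nCk≡0)
open import Data.Nat.Base using (_!)
import Data.Nat.Properties as ℕP
open import Data.Integer as ℤ using (ℤ; +_; -[1+_]; _⊖_)
import Data.Integer.Properties as ℤP
open import Data.Sign as Sign using (Sign)
open import Data.Maybe using (map)
open import Data.Product using (_×_; _,_)
open import Function using (_∘_)
open import Relation.Binary.PropositionalEquality as ≡ using (_≡_; _≢_)
open import Relation.Nullary.Decidable using (dec⇒maybe)
import Algebra.Solver.Ring.AlmostCommutativeRing as ACR
open import Data.Nat.Tactic.RingSolver using (solve-∀)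

triangle : ℕ → ℕ
triangle zero    = 0
triangle (suc n) = triangle n ℕ.+ suc n

n*[n+1]≡2*triangle : ∀ n → n ℕ.* (n ℕ.+ 1) ≡ 2 ℕ.* triangle n
n*[n+1]≡2*triangle zero    = ≡.refl
n*[n+1]≡2*triangle (suc n) = begin
  suc n ℕ.* (suc n ℕ.+ 1)              ≡⟨ step n ⟩
  n ℕ.* (n ℕ.+ 1) ℕ.+ 2 ℕ.* suc n      ≡⟨ ≡.cong (ℕ._+ 2 ℕ.* suc n) (n*[n+1]≡2*triangle n) ⟩
  2 ℕ.* triangle n ℕ.+ 2 ℕ.* suc n     ≡⟨ ℕP.*-distribˡ-+ 2 (triangle n) (suc n) ⟨
  2 ℕ.* triangle (suc n)               ∎
  where
  open ≡.≡-Reasoning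
  step : ∀ n → suc n ℕ.* (suc n ℕ.+ 1) ≡ n ℕ.* (n ℕ.+ 1) ℕ.+ 2 ℕ.* suc n
  step = solve-∀

module Embedding {c ℓ : Level} (R : CommutativeRing c ℓ) where
  open CommutativeRing R
  open RingDefs R
  open import Algebra.Properties.Ring ring
    using (-‿distribˡ-*; -‿distribʳ-*; -‿involutive; -0#≈0#; -‿+-comm; xyx⁻¹≈y)
  open import Relation.Binary.Reasoning.Setoid setoid

  ι-+ : ∀ a b → ι (a ℕ.+ b) ≈ ι a + ι b
  ι-+ zero    b = sym (+-identityˡ _)
  ι-+ (suc a) b = trans (+-congˡ (ι-+ a b)) (sym (+-assoc _ _ _))

  ι-* : ∀ a b → ι (a ℕ.* b) ≈ ι a * ι b
  ι-* zero    b = sym (zeroˡ _)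
  ι-* (suc a) b = begin
    ι (b ℕ.+ a ℕ.* b)      ≈⟨ ι-+ b (a ℕ.* b) ⟩
    ι b + ι (a ℕ.* b)      ≈⟨ +-cong (sym (*-identityˡ _)) (ι-* a b) ⟩
    1# * ι b + ι a * ι b   ≈⟨ distribʳ _ _ _ ⟨
    (1# + ι a) * ι b       ∎

  ιℤ-⊖ : ∀ a b → ιℤ (a ⊖ b) ≈ ι a - ι b
  ιℤ-⊖ a       zero    = trans (sym (+-identityʳ _)) (+-congˡ (sym -0#≈0#))
  ιℤ-⊖ zero    (suc b) = sym (+-identityˡ _)
  ιℤ-⊖ (suc a) (suc b) = begin
    ιℤ (suc a ⊖ suc b)             ≡⟨ ≡.cong ιℤ (ℤP.[1+m]⊖[1+n]≡m⊖n a b) ⟩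
    ιℤ (a ⊖ b)                     ≈⟨ ιℤ-⊖ a b ⟩
    ι a - ι b                      ≈⟨ +-congʳ (xyx⁻¹≈y 1# (ι a)) ⟨
    (1# + ι a) - 1# - ι b          ≈⟨ +-assoc _ _ _ ⟩
    (1# + ι a) + (- 1# - ι b)      ≈⟨ +-congˡ (-‿+-comm 1# (ι b)) ⟩
    ι (suc a) - ι (suc b)          ∎

  ιℤ-+ : ∀ p q → ιℤ (p ℤ.+ q) ≈ ιℤ p + ιℤ q
  ιℤ-+ (+ a)    (+ b)    = ι-+ a b
  ιℤ-+ (+ a)    -[1+ b ] = ιℤ-⊖ a (suc b)
  ιℤ-+ -[1+ a ] (+ b)    = trans (ιℤ-⊖ b (suc a)) (+-comm _ _)
  ιℤ-+ -[1+ a ] -[1+ b ] = begin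
    - ι (suc (suc (a ℕ.+ b)))      ≡⟨ ≡.cong (-_ ∘ ι) (ℕP.+-suc (suc a) b) ⟨
    - ι (suc a ℕ.+ suc b)          ≈⟨ -‿cong (ι-+ (suc a) (suc b)) ⟩
    - (ι (suc a) + ι (suc b))      ≈⟨ -‿+-comm _ _ ⟨
    - ι (suc a) + - ι (suc b)      ∎

  ιℤ-neg : ∀ p → ιℤ (ℤ.- p) ≈ - ιℤ p
  ιℤ-neg (+ zero)  = sym -0#≈0#
  ιℤ-neg (+ suc n) = refl
  ιℤ-neg -[1+ n ]  = sym (-‿involutive _)

  ιℤ-+◃ : ∀ n → ιℤ (Sign.+ ℤ.◃ n) ≈ ι n
  ιℤ-+◃ zero    = refl
  ιℤ-+◃ (suc n) = refl

  ιℤ--◃ : ∀ n → ιℤ (Sign.- ℤ.◃ n) ≈ - ι n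
  ιℤ--◃ zero    = sym -0#≈0#
  ιℤ--◃ (suc n) = refl

  -x*-y≈x*y : ∀ x y → - x * - y ≈ x * y
  -x*-y≈x*y x y = begin
    - x * - y      ≈⟨ -‿distribˡ-* x (- y) ⟨
    - (x * - y)    ≈⟨ -‿cong (-‿distribʳ-* x y) ⟨
    - - (x * y)    ≈⟨ -‿involutive _ ⟩
    x * y          ∎

  ιℤ-* : ∀ p q → ιℤ (p ℤ.* q) ≈ ιℤ p * ιℤ q
  ιℤ-* (+ a)    (+ b)    = trans (ιℤ-+◃ (a ℕ.* b)) (ι-* a b)
  ιℤ-* (+ a)    -[1+ b ] = trans (ιℤ--◃ (a ℕ.* suc b)) (trans (-‿cong (ι-* a (suc b))) (-‿distribʳ-* _ _))
  ιℤ-* -[1+ a ] (+ b)    = trans (ιℤ--◃ (suc a ℕ.* b)) (trans (-‿cong (ι-* (suc a) b)) (-‿distribˡ-* _ _))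
  ιℤ-* -[1+ a ] -[1+ b ] = trans (ιℤ-+◃ (suc a ℕ.* suc b)) (trans (ι-* (suc a) (suc b)) (sym (-x*-y≈x*y _ _)))

  -- ιℤ, but sending + 1 and -[1+ 0 ] to 1# and - 1# on the nose, so that the solver
  -- constants con (+ 1) and con -[1+ 0 ] are literally the 1# and - 1# of the goals.
  ⟦_⟧ℤ : ℤ → Carrier
  ⟦ + 1      ⟧ℤ = 1#
  ⟦ -[1+ 0 ] ⟧ℤ = - 1#
  ⟦ z        ⟧ℤ = ιℤ z

  ⟦⟧ℤ≈ιℤ : ∀ z → ⟦ z ⟧ℤ ≈ ιℤ z
  ⟦⟧ℤ≈ιℤ (+ 0)            = refl
  ⟦⟧ℤ≈ιℤ (+ 1)            = sym (+-identityʳ _)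
  ⟦⟧ℤ≈ιℤ (+ suc (suc n))  = refl
  ⟦⟧ℤ≈ιℤ -[1+ 0 ]         = -‿cong (sym (+-identityʳ _))
  ⟦⟧ℤ≈ιℤ -[1+ suc n ]     = refl

  private
    ℤ⟶R : ℤ.+-*-rawRing ACR.-Raw-AlmostCommutative⟶ ACR.fromCommutativeRing R
    ℤ⟶R = record
      { ⟦_⟧    = ⟦_⟧ℤ
      ; +-homo = λ p q →
          trans (⟦⟧ℤ≈ιℤ (p ℤ.+ q)) (trans (ιℤ-+ p q) (sym (+-cong (⟦⟧ℤ≈ιℤ p) (⟦⟧ℤ≈ιℤ q))))
      ; *-homo = λ p q →
          trans (⟦⟧ℤ≈ιℤ (p ℤ.* q)) (trans (ιℤ-* p q) (sym (*-cong (⟦⟧ℤ≈ιℤ p) (⟦⟧ℤ≈ιℤ q))))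
      ; -‿homo = λ p → trans (⟦⟧ℤ≈ιℤ (ℤ.- p)) (trans (ιℤ-neg p) (sym (-‿cong (⟦⟧ℤ≈ιℤ p))))
      ; 0-homo = refl
      ; 1-homo = refl
      }

  open import Algebra.Solver.Ring ℤ.+-*-rawRing (ACR.fromCommutativeRing R) ℤ⟶R
    (λ p q → map (reflexive ∘ ≡.cong ⟦_⟧ℤ) (dec⇒maybe (p ℤ.≟ q))) public

module FiniteSums {c ℓ : Level} (R : CommutativeRing c ℓ) where
  open CommutativeRing R
  open RingDefs R
  open Embedding R
  open import Algebra.Properties.Ring ring using (-0#≈0#)

  sum1-cong : ∀ k {f g : ℕ → Carrier} → (∀ i → f i ≈ g i) → sum1 k f ≈ sum1 k g
  sum1-cong zero    f≈g = refl
  sum1-cong (suc k) f≈g = +-cong (sum1-cong k f≈g) (f≈g (suc k))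

  prod1-cong : ∀ k {f g : ℕ → Carrier} → (∀ i → f i ≈ g i) → prod1 k f ≈ prod1 k g
  prod1-cong zero    f≈g = refl
  prod1-cong (suc k) f≈g = *-cong (prod1-cong k f≈g) (f≈g (suc k))

  sum1-shift : ∀ k (f : ℕ → Carrier) a → sum1 k (λ i → f i + a) ≈ sum1 k f + ι k * a
  sum1-shift zero    f a = sym (trans (+-congˡ (zeroˡ a)) (+-identityʳ _))
  sum1-shift (suc k) f a = trans (+-congʳ (sum1-shift k f a))
    (solve 4 (λ F K a x → (F :+ K :* a) :+ (x :+ a) := (F :+ x) :+ (con (+ 1) :+ K) :* a)
             refl (sum1 k f) (ι k) a (f (suc k)))

  sum1-- : ∀ k (f g : ℕ → Carrier) → sum1 k (λ i → f i - g i) ≈ sum1 k f - sum1 k g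
  sum1-- zero    f g = sym (trans (+-congˡ -0#≈0#) (+-identityʳ _))
  sum1-- (suc k) f g = trans (+-congʳ (sum1-- k f g))
    (solve 4 (λ F G x y → (F :- G) :+ (x :- y) := (F :+ x) :- (G :+ y))
             refl (sum1 k f) (sum1 k g) (f (suc k)) (g (suc k)))

  sum1-head : ∀ k (f : ℕ → Carrier) → sum1 (suc k) f ≈ f 1 + sum1 k (f ∘ suc)
  sum1-head zero    f = +-comm _ _
  sum1-head (suc k) f = trans (+-congʳ (sum1-head k f)) (+-assoc _ _ _)

  sum0 : ℕ → (ℕ → Carrier) → Carrier
  sum0 n f = f 0 + sum1 n f

  sum0-cong : ∀ k {f g : ℕ → Carrier} → (∀ i → f i ≈ g i) → sum0 k f ≈ sum0 k g
  sum0-cong k f≈g = +-cong (f≈g 0) (sum1-cong k f≈g)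

  sum0-- : ∀ k (f g : ℕ → Carrier) → sum0 k (λ i → f i - g i) ≈ sum0 k f - sum0 k g
  sum0-- k f g = trans (+-congˡ (sum1-- k f g))
    (solve 4 (λ x y F G → (x :- y) :+ (F :- G) := (x :+ F) :- (y :+ G)) refl (f 0) (g 0) (sum1 k f) (sum1 k g))

  sum0-head : ∀ k (f : ℕ → Carrier) → sum0 (suc k) f ≈ f 0 + sum0 k (f ∘ suc)
  sum0-head k f = +-congˡ (sum1-head k f)

  sum0-last : ∀ k (f : ℕ → Carrier) → f (suc k) ≈ 0# → sum0 (suc k) f ≈ sum0 k f
  sum0-last k f f[1+k]≈0 = trans (sym (+-assoc _ _ _)) (trans (+-congˡ f[1+k]≈0) (+-identityʳ _))

module BinomialTransform {c ℓ : Level} (R : CommutativeRing c ℓ) where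
  open CommutativeRing R
  open RingDefs R
  open Embedding R
  open FiniteSums R
  open import Relation.Binary.Reasoning.Setoid setoid

  [-1]^ : ℕ → Carrier
  [-1]^ = pow (- 1#)

  [-1]^-square : ∀ k → [-1]^ k * [-1]^ k ≈ 1#
  [-1]^-square zero    = *-identityˡ _
  [-1]^-square (suc k) = trans
    (solve 1 (λ s → (con -[1+ 0 ] :* s) :* (con -[1+ 0 ] :* s) := s :* s) refl ([-1]^ k))
    ([-1]^-square k)

  binomialTransform : ℕ → (ℕ → Carrier) → Carrier
  binomialTransform zero    g = g 0
  binomialTransform (suc n) g = binomialTransform n g - binomialTransform n (g ∘ suc)

  binomialTransform-cong : ∀ n {f g : ℕ → Carrier} → (∀ t → f t ≈ g t) →
                           binomialTransform n f ≈ binomialTransform n g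
  binomialTransform-cong zero    f≈g = f≈g 0
  binomialTransform-cong (suc n) f≈g =
    +-cong (binomialTransform-cong n f≈g) (-‿cong (binomialTransform-cong n (f≈g ∘ suc)))

  binomialTerm : ℕ → (ℕ → Carrier) → ℕ → Carrier
  binomialTerm n g l = [-1]^ l * ι (n C l) * g l

  binomialTerm-pascal : ∀ n g k →
    binomialTerm (suc n) g (suc k) ≈ binomialTerm n g (suc k) - binomialTerm n (g ∘ suc) k
  binomialTerm-pascal n g k = begin
    [-1]^ (suc k) * ι (suc n C suc k) * g (suc k)
      ≡⟨ ≡.cong (λ b → [-1]^ (suc k) * ι b * g (suc k)) (nCk+nC[k+1]≡[n+1]C[k+1] n k) ⟨
    [-1]^ (suc k) * ι (n C k ℕ.+ n C suc k) * g (suc k)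
      ≈⟨ *-congʳ (*-congˡ (ι-+ (n C k) (n C suc k))) ⟩
    [-1]^ (suc k) * (ι (n C k) + ι (n C suc k)) * g (suc k)
      ≈⟨ solve 4 (λ s p q x → (con -[1+ 0 ] :* s) :* (p :+ q) :* x
                           := (con -[1+ 0 ] :* s) :* q :* x :- s :* p :* x)
               refl ([-1]^ k) (ι (n C k)) (ι (n C suc k)) (g (suc k)) ⟩
    binomialTerm n g (suc k) - binomialTerm n (g ∘ suc) k ∎

  binomialTerm-vanishes : ∀ n g → binomialTerm n g (suc n) ≈ 0#
  binomialTerm-vanishes n g = begin
    [-1]^ (suc n) * ι (n C suc n) * g (suc n)
      ≡⟨ ≡.cong (λ b → [-1]^ (suc n) * ι b * g (suc n)) (k>n⇒nCk≡0 (ℕP.n<1+n n)) ⟩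
    [-1]^ (suc n) * 0# * g (suc n)            ≈⟨ trans (*-congʳ (zeroʳ _)) (zeroˡ _) ⟩
    0#                                        ∎

  binomialTransform-explicit : ∀ n g → binomialTransform n g ≈ sum0 n (binomialTerm n g)
  binomialTransform-explicit zero    g =
    solve 1 (λ x → x := con (+ 1) :* (con (+ 1) :+ con (+ 0)) :* x :+ con (+ 0)) refl (g 0)
  binomialTransform-explicit (suc n) g = begin
    binomialTransform n g - binomialTransform n (g ∘ suc)
      ≈⟨ +-cong (binomialTransform-explicit n g) (-‿cong (binomialTransform-explicit n (g ∘ suc))) ⟩
    sum0 n (T g) - sum0 n (T (g ∘ suc))
      ≈⟨ +-congʳ (sum0-last n (T g) (binomialTerm-vanishes n g)) ⟨
    sum0 (suc n) (T g) - sum0 n (T (g ∘ suc))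
      ≈⟨ trans (+-congʳ (sum0-head n (T g))) (+-assoc _ _ _) ⟩
    T g 0 + (sum0 n (T g ∘ suc) - sum0 n (T (g ∘ suc)))
      ≈⟨ +-congˡ (sum0-- n (T g ∘ suc) (T (g ∘ suc))) ⟨
    T g 0 + sum0 n (λ k → T g (suc k) - T (g ∘ suc) k)
      ≈⟨ +-congˡ (sum0-cong n (λ k → sym (binomialTerm-pascal n g k))) ⟩
    binomialTerm (suc n) g 0 + sum0 n (binomialTerm (suc n) g ∘ suc)
      ≈⟨ sum0-head n (binomialTerm (suc n) g) ⟨
    sum0 (suc n) (binomialTerm (suc n) g) ∎
    where T = binomialTerm n

  binomialTransform-affine : ∀ n a c g →
    binomialTransform (suc n) (λ t → (a * ι t + c) * g t)
      ≈ c * binomialTransform (suc n) g - a * ι (suc n) * binomialTransform n (g ∘ suc)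
  binomialTransform-affine zero    a c g =
    solve 4 (λ a c g₀ g₁ → (a :* con (+ 0) :+ c) :* g₀ :- (a :* (con (+ 1) :+ con (+ 0)) :+ c) :* g₁
                        := c :* (g₀ :- g₁) :- a :* (con (+ 1) :+ con (+ 0)) :* g₁)
            refl a c (g 0) (g 1)
  binomialTransform-affine (suc n) a c g = begin
    B (suc n) (λ t → (a * ι t + c) * g t) - B (suc n) (λ t → (a * ι (suc t) + c) * g (suc t))
      ≈⟨ +-congˡ (-‿cong (binomialTransform-cong (suc n) (λ t → *-congʳ (shift t)))) ⟩
    B (suc n) (λ t → (a * ι t + c) * g t) - B (suc n) (λ t → (a * ι t + (c + a)) * g (suc t))
      ≈⟨ +-cong (binomialTransform-affine n a c g) (-‿cong (binomialTransform-affine n a (c + a) (g ∘ suc))) ⟩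
    (c * B (suc n) g - a * N * B n (g ∘ suc))
      - ((c + a) * B (suc n) (g ∘ suc) - a * N * B n (g ∘ suc ∘ suc))
      ≈⟨ solve 6 (λ a c N G G′ G″ → (c :* G :- a :* N :* G′) :- ((c :+ a) :* (G′ :- G″) :- a :* N :* G″)
                                 := c :* (G :- (G′ :- G″)) :- a :* (con (+ 1) :+ N) :* (G′ :- G″))
               refl a c N (B (suc n) g) (B n (g ∘ suc)) (B n (g ∘ suc ∘ suc)) ⟩
    c * B (suc (suc n)) g - a * ι (suc (suc n)) * B (suc n) (g ∘ suc) ∎
    where
    B = binomialTransform
    N = ι (suc n)
    shift : ∀ t → a * ι (suc t) + c ≈ a * ι t + (c + a)
    shift t = solve 3 (λ a c x → a :* (con (+ 1) :+ x) :+ c := a :* x :+ (c :+ a)) refl a c (ι t)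

  linearProduct : Carrier → (ℕ → Carrier) → ℕ → ℕ → Carrier
  linearProduct a y k t = prod1 k (λ i → a * ι t + y i)

  linearProduct-suc : ∀ a y k t → linearProduct a y k (suc t) ≈ linearProduct a (λ i → y i + a) k t
  linearProduct-suc a y k t = prod1-cong k (λ i →
    solve 3 (λ a y x → a :* (con (+ 1) :+ x) :+ y := a :* x :+ (y :+ a)) refl a (y i) (ι t))

  binomialTransform-linearProduct : ∀ n k a y →
    binomialTransform (suc n) (linearProduct a y (suc k))
      ≈ y (suc k) * binomialTransform (suc n) (linearProduct a y k)
        - a * ι (suc n) * binomialTransform n (linearProduct a (λ i → y i + a) k)
  binomialTransform-linearProduct n k a y = begin
    binomialTransform (suc n) (linearProduct a y (suc k))
      ≈⟨ binomialTransform-cong (suc n) (λ t → *-comm _ _) ⟩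
    binomialTransform (suc n) (λ t → (a * ι t + y (suc k)) * linearProduct a y k t)
      ≈⟨ binomialTransform-affine n a (y (suc k)) (linearProduct a y k) ⟩
    y (suc k) * binomialTransform (suc n) (linearProduct a y k)
      - a * ι (suc n) * binomialTransform n (linearProduct a y k ∘ suc)
      ≈⟨ +-congˡ (-‿cong (*-congˡ (binomialTransform-cong n (linearProduct-suc a y k)))) ⟩
    y (suc k) * binomialTransform (suc n) (linearProduct a y k)
      - a * ι (suc n) * binomialTransform n (linearProduct a (λ i → y i + a) k) ∎

  binomialTransform-linearProduct-< : ∀ {k n} → k < n → ∀ a y → binomialTransform n (linearProduct a y k) ≈ 0#
  binomialTransform-linearProduct-< {zero}  {suc n} _         a y = -‿inverseʳ _
  binomialTransform-linearProduct-< {suc k} {suc n} (s≤s k<n) a y = begin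
    binomialTransform (suc n) (linearProduct a y (suc k))
      ≈⟨ binomialTransform-linearProduct n k a y ⟩
    y (suc k) * binomialTransform (suc n) (linearProduct a y k)
      - a * ι (suc n) * binomialTransform n (linearProduct a (λ i → y i + a) k)
      ≈⟨ +-cong (*-congˡ (binomialTransform-linearProduct-< (ℕP.m<n⇒m<1+n k<n) a y))
                (-‿cong (*-congˡ (binomialTransform-linearProduct-< k<n a (λ i → y i + a)))) ⟩
    y (suc k) * 0# - a * ι (suc n) * 0#
      ≈⟨ solve 3 (λ y a N → y :* con (+ 0) :- a :* N :* con (+ 0) := con (+ 0)) refl (y (suc k)) a (ι (suc n)) ⟩
    0# ∎

  binomialTransform-linearProduct-diagonal : ∀ n a y →
    binomialTransform n (linearProduct a y n) ≈ [-1]^ n * ι (n !) * pow a n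
  binomialTransform-linearProduct-diagonal zero    a y =
    solve 0 (con (+ 1) := con (+ 1) :* (con (+ 1) :+ con (+ 0)) :* con (+ 1)) refl
  binomialTransform-linearProduct-diagonal (suc n) a y = begin
    binomialTransform (suc n) (linearProduct a y (suc n))
      ≈⟨ binomialTransform-linearProduct n n a y ⟩
    y (suc n) * binomialTransform (suc n) (linearProduct a y n)
      - a * ι (suc n) * binomialTransform n (linearProduct a (λ i → y i + a) n)
      ≈⟨ +-cong (*-congˡ (binomialTransform-linearProduct-< (ℕP.n<1+n n) a y))
                (-‿cong (*-congˡ (binomialTransform-linearProduct-diagonal n a (λ i → y i + a)))) ⟩
    y (suc n) * 0# - a * ι (suc n) * ([-1]^ n * ι (n !) * pow a n)
      ≈⟨ solve 6 (λ y a N s F p → y :* con (+ 0) :- a :* N :* (s :* F :* p)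
                               := (con -[1+ 0 ] :* s) :* (N :* F) :* (a :* p))
               refl (y (suc n)) a (ι (suc n)) ([-1]^ n) (ι (n !)) (pow a n) ⟩
    [-1]^ (suc n) * (ι (suc n) * ι (n !)) * pow a (suc n)
      ≈⟨ *-congʳ (*-congˡ (ι-* (suc n) (n !))) ⟨
    [-1]^ (suc n) * ι (suc n !) * pow a (suc n) ∎

  binomialTransform-linearProduct-superdiagonal : ∀ n a y →
    binomialTransform n (linearProduct a y (suc n))
      ≈ [-1]^ n * ι (n !) * pow a n * (sum1 (suc n) y + a * ι (triangle n))
  binomialTransform-linearProduct-superdiagonal zero    a y =
    solve 2 (λ a y → con (+ 1) :* (a :* con (+ 0) :+ y)
                  := con (+ 1) :* (con (+ 1) :+ con (+ 0)) :* con (+ 1) :* ((con (+ 0) :+ y) :+ a :* con (+ 0)))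
            refl a (y 1)
  binomialTransform-linearProduct-superdiagonal (suc n) a y = begin
    binomialTransform (suc n) (linearProduct a y (suc (suc n)))
      ≈⟨ binomialTransform-linearProduct n (suc n) a y ⟩
    y (suc (suc n)) * binomialTransform (suc n) (linearProduct a y (suc n))
      - a * N * binomialTransform n (linearProduct a y′ (suc n))
      ≈⟨ +-cong (*-congˡ (binomialTransform-linearProduct-diagonal (suc n) a y))
                (-‿cong (*-congˡ (binomialTransform-linearProduct-superdiagonal n a y′))) ⟩
    y (suc (suc n)) * ([-1]^ (suc n) * ι (suc n !) * pow a (suc n))
      - a * N * ([-1]^ n * F * pow a n * (sum1 (suc n) y′ + a * T))
      ≈⟨ +-cong (*-congˡ (*-congʳ (*-congˡ (ι-* (suc n) (n !)))))
                (-‿cong (*-congˡ (*-congˡ (+-congʳ (sum1-shift (suc n) y a))))) ⟩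
    Y * ([-1]^ (suc n) * (N * F) * pow a (suc n))
      - a * N * ([-1]^ n * F * pow a n * ((Σy + N * a) + a * T))
      ≈⟨ solve 8 (λ Y N F s p a Σy T →
            Y :* ((con -[1+ 0 ] :* s) :* (N :* F) :* (a :* p)) :- a :* N :* (s :* F :* p :* ((Σy :+ N :* a) :+ a :* T))
         := (con -[1+ 0 ] :* s) :* (N :* F) :* (a :* p) :* ((Σy :+ Y) :+ a :* (T :+ N)))
         refl Y N F ([-1]^ n) (pow a n) a Σy T ⟩
    [-1]^ (suc n) * (N * F) * pow a (suc n) * ((Σy + Y) + a * (T + N))
      ≈⟨ *-cong (*-congʳ (*-congˡ (ι-* (suc n) (n !)))) (+-congˡ (*-congˡ (ι-+ (triangle n) (suc n)))) ⟨
    [-1]^ (suc n) * ι (suc n !) * pow a (suc n) * (sum1 (suc (suc n)) y + a * ι (triangle (suc n))) ∎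
    where
    y′ = λ i → y i + a
    Y  = y (suc (suc n))
    N  = ι (suc n)
    F  = ι (n !)
    Σy = sum1 (suc n) y
    T  = ι (triangle n)

  binomialTransform-ι*linearProduct : ∀ n a y →
    binomialTransform (suc n) (λ t → ι t * linearProduct a y (suc n) t)
      ≈ [-1]^ (suc n) * ι (suc n !) * pow a n * (sum1 (suc n) y + a * ι (triangle (suc n)))
  binomialTransform-ι*linearProduct n a y = begin
    binomialTransform (suc n) (λ t → ι t * P t)
      ≈⟨ binomialTransform-cong (suc n) (λ t →
           *-congʳ (solve 1 (λ x → x := con (+ 1) :* x :+ con (+ 0)) refl (ι t))) ⟩
    binomialTransform (suc n) (λ t → (1# * ι t + 0#) * P t)
      ≈⟨ binomialTransform-affine n 1# 0# P ⟩
    0# * binomialTransform (suc n) P - 1# * N * binomialTransform n (P ∘ suc)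
      ≈⟨ +-congˡ (-‿cong (*-congˡ (binomialTransform-cong n (linearProduct-suc a y (suc n))))) ⟩
    0# * binomialTransform (suc n) P - 1# * N * binomialTransform n (linearProduct a y′ (suc n))
      ≈⟨ +-congˡ (-‿cong (*-congˡ (binomialTransform-linearProduct-superdiagonal n a y′))) ⟩
    0# * binomialTransform (suc n) P - 1# * N * ([-1]^ n * F * pow a n * (sum1 (suc n) y′ + a * T))
      ≈⟨ +-congˡ (-‿cong (*-congˡ (*-congˡ (+-congʳ (sum1-shift (suc n) y a))))) ⟩
    0# * binomialTransform (suc n) P - 1# * N * ([-1]^ n * F * pow a n * ((Σy + N * a) + a * T))
      ≈⟨ solve 8 (λ Z N s F p Σy a T →
            con (+ 0) :* Z :- con (+ 1) :* N :* (s :* F :* p :* ((Σy :+ N :* a) :+ a :* T))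
         := (con -[1+ 0 ] :* s) :* (N :* F) :* p :* (Σy :+ a :* (T :+ N)))
         refl (binomialTransform (suc n) P) N ([-1]^ n) F (pow a n) Σy a T ⟩
    [-1]^ (suc n) * (N * F) * pow a n * (Σy + a * (T + N))
      ≈⟨ *-cong (*-congʳ (*-congˡ (ι-* (suc n) (n !)))) (+-congˡ (*-congˡ (ι-+ (triangle n) (suc n)))) ⟨
    [-1]^ (suc n) * ι (suc n !) * pow a n * (sum1 (suc n) y + a * ι (triangle (suc n))) ∎
    where
    P  = linearProduct a y (suc n)
    y′ = λ i → y i + a
    N  = ι (suc n)
    F  = ι (n !)
    Σy = sum1 (suc n) y
    T  = ι (triangle n)

  alternatingSum-ι*linearProduct : ∀ n a y →
    sum1 (suc n) (λ l → [-1]^ l * ι (suc n C l) * ι l * linearProduct a y (suc n) l)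
      ≈ [-1]^ (suc n) * ι (suc n !) * pow a n * (sum1 (suc n) y + a * ι (triangle (suc n)))
  alternatingSum-ι*linearProduct n a y = begin
    sum1 (suc n) (λ l → [-1]^ l * ι (suc n C l) * ι l * P l)
      ≈⟨ sum1-cong (suc n) (λ l → *-assoc _ _ _) ⟩
    sum1 (suc n) (binomialTerm (suc n) g)
      ≈⟨ +-identityˡ _ ⟨
    0# + sum1 (suc n) (binomialTerm (suc n) g)
      ≈⟨ +-congʳ (solve 1 (λ x → con (+ 1) :* (con (+ 1) :+ con (+ 0)) :* (con (+ 0) :* x) := con (+ 0))
                          refl (P 0)) ⟨
    sum0 (suc n) (binomialTerm (suc n) g)
      ≈⟨ binomialTransform-explicit (suc n) g ⟨
    binomialTransform (suc n) g
      ≈⟨ binomialTransform-ι*linearProduct n a y ⟩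
    [-1]^ (suc n) * ι (suc n !) * pow a n * (sum1 (suc n) y + a * ι (triangle (suc n))) ∎
    where
    P = linearProduct a y (suc n)
    g = λ t → ι t * P t

module Formulas {c ℓ : Level} (R : CommutativeRing c ℓ) where
  open CommutativeRing R
  open RingDefs R
  open Embedding R
  open FiniteSums R
  open BinomialTransform R
  open import Relation.Binary.Reasoning.Setoid setoid

  pow-1# : ∀ k → pow 1# k ≈ 1#
  pow-1# zero    = refl
  pow-1# (suc k) = trans (*-congˡ (pow-1# k)) (*-identityˡ _)

  cancel-prefactor : ∀ k {d F p} z → d * (F * p) ≈ 1# → d * [-1]^ k * ([-1]^ k * F * p * z) ≈ z
  cancel-prefactor k {d} {F} {p} z dFp≈1 = begin
    d * s * (s * F * p * z)  ≈⟨ solve 5 (λ d s F p z → d :* s :* (s :* F :* p :* z) := d :* (F :* p) :* (s :* s) :* z)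
                                       refl d s F p z ⟩
    d * (F * p) * (s * s) * z ≈⟨ *-congʳ (*-cong dFp≈1 ([-1]^-square k)) ⟩
    1# * 1# * z               ≈⟨ trans (*-congʳ (*-identityˡ 1#)) (*-identityˡ z) ⟩
    z                         ∎
    where s = [-1]^ k

  halve-pronic : ∀ n {h} → h * ι 2 ≈ 1# → h * ι (n ℕ.* (n ℕ.+ 1)) ≈ ι (triangle n)
  halve-pronic n {h} h2≈1 = begin
    h * ι (n ℕ.* (n ℕ.+ 1))   ≡⟨ ≡.cong (λ k → h * ι k) (n*[n+1]≡2*triangle n) ⟩
    h * ι (2 ℕ.* triangle n)  ≈⟨ *-congˡ (ι-* 2 (triangle n)) ⟩
    h * (ι 2 * ι (triangle n)) ≈⟨ sym (*-assoc _ _ _) ⟩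
    h * ι 2 * ι (triangle n)  ≈⟨ trans (*-congʳ h2≈1) (*-identityˡ _) ⟩
    ι (triangle n)            ∎

  𝒳-shiftFormula : ∀ (x : ℕ → ℕ → Carrier) n (m : ℤ) (h d : Carrier) →
    h * ι 2 ≈ 1# → d * ι (suc n !) ≈ 1# →
    𝒳 x (suc n) ≈ (d * [-1]^ (suc n)) * sum1 (suc n) (λ l → [-1]^ l * ι (suc n C l) * ι l * X x (suc n) (+ l ℤ.+ m))
                  - h * ι (suc n ℕ.* (suc n ℕ.+ 1)) - ι (suc n) * ιℤ m
  𝒳-shiftFormula x n m h d h2≈1 dF≈1 = sym (begin
    d * s * Σ - h * ι (K ℕ.* (K ℕ.+ 1)) - N * M
      ≈⟨ +-congʳ (+-cong (*-congˡ Σ≈) (-‿cong (halve-pronic K h2≈1))) ⟩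
    d * s * (s * F * pow 1# n * ((𝒳 x K + N * M) + 1# * T)) - T - N * M
      ≈⟨ +-congʳ (+-congʳ (cancel-prefactor K _
           (trans (*-congˡ (trans (*-congˡ (pow-1# n)) (*-identityʳ F))) dF≈1))) ⟩
    ((𝒳 x K + N * M) + 1# * T) - T - N * M
      ≈⟨ solve 4 (λ X N M T → ((X :+ N :* M) :+ con (+ 1) :* T) :- T :- N :* M := X) refl (𝒳 x K) N M T ⟩
    𝒳 x K ∎)
    where
    K = suc n
    s = [-1]^ K
    M = ιℤ m
    N = ι K
    F = ι (K !)
    T = ι (triangle K)
    Σ = sum1 K (λ l → [-1]^ l * ι (K C l) * ι l * X x K (+ l ℤ.+ m))
    Σ≈ : Σ ≈ s * F * pow 1# n * ((𝒳 x K + N * M) + 1# * T)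
    Σ≈ = begin
      Σ ≈⟨ sum1-cong K (λ l → *-congˡ (prod1-cong K (λ i → trans (+-congʳ (ιℤ-+ (+ l) m))
             (solve 3 (λ l M y → (l :+ M) :+ y := con (+ 1) :* l :+ (y :+ M)) refl (ι l) M (x K i))))) ⟩
      sum1 K (λ l → [-1]^ l * ι (K C l) * ι l * linearProduct 1# (λ i → x K i + M) K l)
        ≈⟨ alternatingSum-ι*linearProduct n 1# (λ i → x K i + M) ⟩
      s * F * pow 1# n * (sum1 K (λ i → x K i + M) + 1# * T)
        ≈⟨ *-congˡ (+-congʳ (sum1-shift K (x K) M)) ⟩
      s * F * pow 1# n * ((𝒳 x K + N * M) + 1# * T) ∎

  𝒳-scaleFormula : ∀ (x : ℕ → ℕ → Carrier) n (m : ℤ) (h d : Carrier) →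
    h * ι 2 ≈ 1# → d * (ι (suc n !) * pow (ιℤ m) n) ≈ 1# →
    𝒳 x (suc n) ≈ (d * [-1]^ (suc n)) * sum1 (suc n) (λ l → [-1]^ l * ι (suc n C l) * ι l * X x (suc n) (+ l ℤ.* m))
                  - h * ι (suc n ℕ.* (suc n ℕ.+ 1)) * ιℤ m
  𝒳-scaleFormula x n m h d h2≈1 dFp≈1 = sym (begin
    d * s * Σ - h * ι (K ℕ.* (K ℕ.+ 1)) * M
      ≈⟨ +-cong (*-congˡ Σ≈) (-‿cong (*-congʳ (halve-pronic K h2≈1))) ⟩
    d * s * (s * ι (K !) * pow M n * (𝒳 x K + M * T)) - T * M
      ≈⟨ +-congʳ (cancel-prefactor K _ dFp≈1) ⟩
    (𝒳 x K + M * T) - T * M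
      ≈⟨ solve 3 (λ X M T → (X :+ M :* T) :- T :* M := X) refl (𝒳 x K) M T ⟩
    𝒳 x K ∎)
    where
    K = suc n
    s = [-1]^ K
    M = ιℤ m
    T = ι (triangle K)
    Σ = sum1 K (λ l → [-1]^ l * ι (K C l) * ι l * X x K (+ l ℤ.* m))
    Σ≈ : Σ ≈ s * ι (K !) * pow M n * (𝒳 x K + M * T)
    Σ≈ = begin
      Σ ≈⟨ sum1-cong K (λ l → *-congˡ (prod1-cong K (λ i → +-congʳ (trans (ιℤ-* (+ l) m) (*-comm _ _))))) ⟩
      sum1 K (λ l → [-1]^ l * ι (K C l) * ι l * linearProduct M (x K) K l)
        ≈⟨ alternatingSum-ι*linearProduct n M (x K) ⟩
      s * ι (K !) * pow M n * (𝒳 x K + M * T) ∎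

lemma2p2 : ∀ {c ℓ : Level} (R : CommutativeRing c ℓ) →
    let open CommutativeRing R in
    let open RingDefs R in
    (x : ℕ → ℕ → Carrier) (n : ℕ) → 1 ≤ n → (m : ℤ) →
    (∀ (h d : Carrier) → h * ι 2 ≈ 1# → d * ι (n !) ≈ 1# →
      𝒳 x n ≈ (d * pow (- 1#) n) * sum1 n (λ l → pow (- 1#) l * ι (n C l) * ι l * X x n (+ l ℤ.+ m))
               - h * ι (n ℕ.* (n ℕ.+ 1))
               - ι n * ιℤ m)
    ×
    (m ≢ + 0 → ∀ (h d : Carrier) → h * ι 2 ≈ 1# → d * (ι (n !) * pow (ιℤ m) (n ℕ.∸ 1)) ≈ 1# →
      𝒳 x n ≈ (d * pow (- 1#) n) * sum1 n (λ l → pow (- 1#) l * ι (n C l) * ι l * X x n (+ l ℤ.* m))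
               - h * ι (n ℕ.* (n ℕ.+ 1)) * ιℤ m)
lemma2p2 R x (suc n) (s≤s z≤n) m =
  Formulas.𝒳-shiftFormula R x n m , λ _ → Formulas.𝒳-scaleFormula R x n m
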